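{- Let $k\geq 2$ and $n\geq 1$ be integers, let $L(Wd(k,n))$ be the line graph of the Windmill graph $Wd(k,n)$, and let $\Delta$ be the maximum degree of $L(Wd(k,n))$. Then $$\chi_\Delta(L(Wd(k,n))) = n(k-1)+\binom{k-1}{2}.$$
   Context: The Windmill graph $Wd(k,n)$ consists of $n$ copies of the complete graph $K_k$ in which one vertex from each copy is identified into a single common center vertex. For a graph $G$, $N_G(v)$ is the neighborhood of $v$, $d(v)=|N_G(v)|$, and $c(S)=\{c(u):u\in S\}$. For integers $k'>0$ and $r\geq 0$, a conditional $(k',r)$-coloring of $G$ is a surjective map $c\colon V(G)\to\{1,\ldots,k'\}$ such that $c(u)\neq c(v)$ for every edge $uv$, and $|c(N_G(v))|\geq \min\{d(v),r\}$ for every vertex $v$. $\chi_r(G)$ denotes the smallest $k'$ such that $G$ has a conditional $(k',r)$-coloring. -}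

module Defs where

open import Data.Bool using (Bool; true; false; _∧_; _∨_; not)
open import Data.Nat using (ℕ; _+_; _*_; _∸_; _⊔_; _≤_; _<_)
open import Data.Fin using (Fin)
import Data.Fin as Fin
open import Data.Fin.Properties using () renaming (_≟_ to _≟ᶠ_)
open import Data.List using (List; []; _∷_; _++_; map; filter; length; foldr; deduplicate; cartesianProduct; allFin; lookup)
open import Data.Maybe using (Maybe; nothing; just)
import Data.Maybe.Properties as MaybeP
import Data.Product.Properties as ProdP
open import Data.Product using (_×_; _,_; ∃; Σ)
open import Relation.Binary.Definitions using (DecidableEquality)
open import Relation.Binary.PropositionalEquality using (_≡_; _≢_)
open import Relation.Nullary.Decidable using (⌊_⌋)
open import Data.Bool using (T)

-- A finite simple graph, given by a vertex type, an enumeration of its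
-- vertices (each exactly once), decidable equality, and a Boolean adjacency.
record Graph : Set₁ where
  field
    V     : Set
    _≟_   : DecidableEquality V
    verts : List V
    adj   : V → V → Bool

module _ (G : Graph) where
  open Graph G

  pairs : List V → List (V × V)
  pairs [] = []
  pairs (u ∷ vs) = map (u ,_) vs ++ pairs vs

  edges : List (V × V)
  edges = filter (λ e → Data.Bool._≟_ (adj (Data.Product.proj₁ e) (Data.Product.proj₂ e)) true) (pairs verts)

  nbhd : V → List V
  nbhd v = filter (λ u → Data.Bool._≟_ (adj v u) true) verts

  deg : V → ℕ
  deg v = length (nbhd v)

  maxDeg : ℕ
  maxDeg = foldr _⊔_ 0 (map deg verts)

  record CondColoring (k′ r : ℕ) : Set where
    field
      c          : V → Fin k′
      positive   : 0 < k′
      surjective : ∀ (j : Fin k′) → ∃ λ v → c v ≡ j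
      proper     : ∀ u v → T (adj u v) → c u ≢ c v
      condition  : ∀ v → (deg v Data.Nat.⊓ r) ≤ length (deduplicate _≟ᶠ_ (map c (nbhd v)))

  IsCondChromatic : ℕ → ℕ → Set
  IsCondChromatic r m = CondColoring m r × (∀ k′ → CondColoring k′ r → m ≤ k′)

lineGraph : Graph → Graph
lineGraph G = record
  { V = Fin (length E)
  ; _≟_ = _≟ᶠ_
  ; verts = allFin (length E)
  ; adj = λ i j → not ⌊ i ≟ᶠ j ⌋ ∧ share (lookup E i) (lookup E j)
  }
  where
    open Graph G
    E = edges G
    share : V × V → V × V → Bool
    share (a , b) (c , d) = ⌊ a ≟ c ⌋ ∨ ⌊ a ≟ d ⌋ ∨ ⌊ b ≟ c ⌋ ∨ ⌊ b ≟ d ⌋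

-- Windmill graph Wd(k,n): center = nothing, (i , j) = j-th non-center vertex
-- of the i-th copy of K_k.
windmill : ℕ → ℕ → Graph
windmill k n = record
  { V = Maybe (Fin n × Fin (k ∸ 1))
  ; _≟_ = MaybeP.≡-dec (ProdP.≡-dec _≟ᶠ_ _≟ᶠ_)
  ; verts = nothing ∷ map just (cartesianProduct (allFin n) (allFin (k ∸ 1)))
  ; adj = wadj
  }
  where
    wadj : Maybe (Fin n × Fin (k ∸ 1)) → Maybe (Fin n × Fin (k ∸ 1)) → Bool
    wadj nothing nothing = false
    wadj nothing (just _) = true
    wadj (just _) nothing = true
    wadj (just (i , j)) (just (i′ , j′)) = ⌊ i ≟ᶠ i′ ⌋ ∧ not ⌊ j ≟ᶠ j′ ⌋

-- The edges of Wd(k,n) are the n(k−1) spokes at the center and, inside copy i, the blades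
-- {(i,j),(i,j′)}. Since Δ bounds every degree, a conditional (χ,Δ)-coloring of the line graph
-- is injective on every neighborhood, so two edges that meet a common edge get distinct colors.
-- All spokes together with the blades of one copy pairwise meet a common edge, which forces
-- n(k−1) + C(k−1,2) colors. Conversely, color each spoke individually and each blade by its
-- pair {j,j′}, ignoring the copy: no edge meets two copies, so two distinct edges of the same
-- color never meet a common edge, and this coloring is proper with rainbow neighborhoods.

module Submission where

open import Defs
open import Data.Bool using (Bool; _∨_; T)
open import Data.Bool.Properties using (T-≡)
open import Data.Empty using (⊥; ⊥-elim)
import Data.Empty.Irrelevant as Irrelevant
open import Data.Fin using (Fin; zero; suc; _↑ˡ_; _↑ʳ_; splitAt; join; combine; cast)
open import Data.Fin.Properties
  using (↑ˡ-injective; ↑ʳ-injective; splitAt-↑ˡ; splitAt-↑ʳ; splitAt-join; join-splitAt;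
         suc-injective; combine-injective; combine-surjective; cast-involutive; injective⇒≤)
  renaming (_≟_ to _≟ᶠ_)
open import Data.List using (List; []; _∷_; map; length; foldr; deduplicate; allFin; lookup; cartesianProduct)
open import Data.List.Properties using (length-deduplicate; length-filter; filter-all; filter-notAll; length-map)
open import Data.List.Membership.Propositional using (_∈_)
open import Data.List.Membership.Propositional.Properties
  using (∈-map⁺; ∈-map⁻; ∈-++⁺ˡ; ∈-++⁺ʳ; ∈-++⁻; ∈-filter⁺; ∈-filter⁻; ∈-allFin;
         ∈-lookup; ∈-deduplicate⁺; ∈-deduplicate⁻; ∈-cartesianProduct⁺)
open import Data.List.Relation.Unary.Any using (here; there; index)
import Data.List.Relation.Unary.Any as Any
open import Data.List.Relation.Unary.Any.Properties using (lookup-index)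
open import Data.List.Relation.Unary.All as All using (All)
open import Data.List.Relation.Unary.AllPairs using ([]; _∷_)
open import Data.List.Relation.Unary.Unique.Propositional using (Unique)
import Data.List.Relation.Unary.Unique.Propositional.Properties as Unique
open import Data.Nat using (ℕ; zero; suc; _+_; _*_; _∸_; _⊔_; _⊓_; _≤_; _<_; z≤n; s≤s)
open import Data.Nat.Combinatorics using (_C_; nC1≡n; nCk+nC[k+1]≡[n+1]C[k+1])
open import Data.Nat.Properties
  using (≤-trans; m≤m⊔n; m≤n⊔m; m⊓n≤m; m≤n⇒m⊓n≡m; <-irrefl; <-≤-trans; module ≤-Reasoning)
open import Data.Product using (_×_; _,_; ∃; ∃₂; Σ; proj₁; proj₂; swap)
open import Data.Sum using (_⊎_; inj₁; inj₂)
open import Data.Sum.Properties using (inj₁-injective; inj₂-injective)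
open import Data.Maybe using (nothing; just)
open import Data.Maybe.Properties using (just-injective)
open import Relation.Binary.Definitions using (DecidableEquality)
open import Relation.Binary.PropositionalEquality
  using (_≡_; _≢_; refl; sym; trans; cong; cong₂; subst; module ≡-Reasoning)
open import Relation.Nullary using (¬_; yes; no)
open import Relation.Nullary.Decidable using (⌊_⌋)
open import Function.Bundles using (Equivalence)

Same : {A : Set} → A × A → A × A → Set
Same e f = e ≡ f ⊎ e ≡ swap f

Same-sym : {A : Set} {e f : A × A} → Same e f → Same f e
Same-sym (inj₁ refl) = inj₁ refl
Same-sym (inj₂ refl) = inj₂ refl

Same-trans : {A : Set} {e f g : A × A} → Same e f → Same f g → Same e g
Same-trans (inj₁ refl) q = q
Same-trans (inj₂ refl) (inj₁ refl) = inj₂ refl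
Same-trans (inj₂ refl) (inj₂ refl) = inj₁ refl

Ends : {A : Set} → A → A × A → Set
Ends z (a , b) = z ≡ a ⊎ z ≡ b

Ends-resp-Same : {A : Set} {z : A} {e f : A × A} → Same e f → Ends z e → Ends z f
Ends-resp-Same (inj₁ refl) h = h
Ends-resp-Same (inj₂ refl) (inj₁ h) = inj₂ h
Ends-resp-Same (inj₂ refl) (inj₂ h) = inj₁ h

Meet : {A : Set} → A × A → A × A → Set
Meet e f = ∃ λ z → Ends z e × Ends z f

Meet-refl : {A : Set} (e : A × A) → Meet e e
Meet-refl (a , _) = a , inj₁ refl , inj₁ refl

Meet-sym : {A : Set} {e f : A × A} → Meet e f → Meet f e
Meet-sym (z , hₑ , h_f) = z , h_f , hₑ

Meet-resp-Same : {A : Set} {e e′ f f′ : A × A} → Same e e′ → Same f f′ → Meet e f → Meet e′ f′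
Meet-resp-Same p q (z , hₑ , h_f) = z , Ends-resp-Same p hₑ , Ends-resp-Same q h_f

module _ {A : Set} (_≟_ : DecidableEquality A) where

  length-deduplicate-unique : ∀ {xs : List A} → Unique xs → length (deduplicate _≟_ xs) ≡ length xs
  length-deduplicate-unique {[]} _ = refl
  length-deduplicate-unique {x ∷ xs} (x∉xs ∷ u) =
    cong suc (trans (cong length (filter-all _ x∉ys)) (length-deduplicate-unique u))
    where
    x∉ys : All (λ y → ¬ x ≡ y) (deduplicate _≟_ xs)
    x∉ys = All.tabulate (λ y∈ → All.lookup x∉xs (∈-deduplicate⁻ _≟_ xs y∈))

  unique-if-length-deduplicate : ∀ (xs : List A) → length xs ≤ length (deduplicate _≟_ xs) → Unique xs
  unique-if-length-deduplicate [] _ = []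
  unique-if-length-deduplicate (x ∷ xs) (s≤s h) =
    All.tabulate x∉xs ∷ unique-if-length-deduplicate xs (≤-trans h (length-filter _ ys))
    where
    ys = deduplicate _≟_ xs
    -- if x occurred in xs the filter would drop it from ys, making the list too short
    x∉xs : ∀ {y} → y ∈ xs → x ≢ y
    x∉xs y∈xs refl = <-irrefl refl (<-≤-trans
      (filter-notAll _ ys (Any.map (λ { refl x≢x → x≢x refl }) (∈-deduplicate⁺ _≟_ y∈xs)))
      (≤-trans (length-deduplicate _≟_ xs) h))

module _ {A B : Set} (f : A → B) where

  map-unique⁺ : ∀ {xs : List A} → (∀ {x y} → x ∈ xs → y ∈ xs → f x ≡ f y → x ≡ y) →
                Unique xs → Unique (map f xs)
  map-unique⁺ {[]} _ _ = []
  map-unique⁺ {x ∷ xs} inj (x∉xs ∷ u) =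
    All.tabulate (λ fy∈ fx≡ → let (y , y∈ , ≡fy) = ∈-map⁻ f fy∈ in
                    All.lookup x∉xs y∈ (inj (here refl) (there y∈) (trans fx≡ ≡fy)))
    ∷ map-unique⁺ (λ p q → inj (there p) (there q)) u

  map-unique⁻ : ∀ {xs : List A} → Unique (map f xs) →
                ∀ {x y} → x ∈ xs → y ∈ xs → f x ≡ f y → x ≡ y
  map-unique⁻ _ (here refl) (here refl) _ = refl
  map-unique⁻ (fx∉ ∷ _) (here refl) (there y∈) e = ⊥-elim (All.lookup fx∉ (∈-map⁺ f y∈) e)
  map-unique⁻ (fy∉ ∷ _) (there x∈) (here refl) e = ⊥-elim (All.lookup fy∉ (∈-map⁺ f x∈) (sym e))
  map-unique⁻ (_ ∷ u) (there x∈) (there y∈) e = map-unique⁻ u x∈ y∈ e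

≤-foldr-⊔ : {A : Set} (g : A → ℕ) {x : A} {xs : List A} → x ∈ xs → g x ≤ foldr _⊔_ 0 (map g xs)
≤-foldr-⊔ g (here refl) = m≤m⊔n _ _
≤-foldr-⊔ g {xs = y ∷ _} (there x∈) = ≤-trans (≤-foldr-⊔ g x∈) (m≤n⊔m (g y) _)

lookup-injective : {A : Set} {xs : List A} → Unique xs → ∀ i j → lookup xs i ≡ lookup xs j → i ≡ j
lookup-injective {xs = _ ∷ _} _ zero zero _ = refl
lookup-injective {xs = _ ∷ xs} (x∉ ∷ _) zero (suc j) e =
  ⊥-elim (All.lookup x∉ (∈-lookup {xs = xs} j) e)
lookup-injective {xs = _ ∷ xs} (x∉ ∷ _) (suc i) zero e =
  ⊥-elim (All.lookup x∉ (∈-lookup {xs = xs} i) (sym e))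
lookup-injective {xs = _ ∷ _} (_ ∷ u) (suc i) (suc j) e = cong suc (lookup-injective u i j e)

module ConditionalColoring (H : Graph) where
  open Graph H

  ∈-nbhd⁻ : ∀ {w x} → x ∈ nbhd H w → T (adj w x)
  ∈-nbhd⁻ x∈ = Equivalence.from T-≡ (proj₂ (∈-filter⁻ _ {xs = verts} x∈))

  ∈-nbhd⁺ : ∀ {w x} → x ∈ verts → T (adj w x) → x ∈ nbhd H w
  ∈-nbhd⁺ x∈ a = ∈-filter⁺ _ x∈ (Equivalence.to T-≡ a)

  rainbow⇒condColoring : ∀ {k′} r (c : V → Fin k′) → 0 < k′ → Unique verts →
    (∀ j → ∃ λ v → c v ≡ j) →
    (∀ u v → T (adj u v) → c u ≢ c v) →
    (∀ {w x y} → T (adj w x) → T (adj w y) → c x ≡ c y → x ≡ y) →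
    CondColoring H k′ r
  rainbow⇒condColoring r c k′>0 verts-unique surj proper rainbow = record
    { c = c ; positive = k′>0 ; surjective = surj ; proper = proper ; condition = condition }
    where
    condition : ∀ v → deg H v ⊓ r ≤ length (deduplicate _≟ᶠ_ (map c (nbhd H v)))
    condition v = begin
      deg H v ⊓ r                                    ≤⟨ m⊓n≤m _ r ⟩
      deg H v                                        ≡⟨ length-map c (nbhd H v) ⟨
      length (map c (nbhd H v))                      ≡⟨ length-deduplicate-unique _≟ᶠ_ rainbow-nbhd ⟨
      length (deduplicate _≟ᶠ_ (map c (nbhd H v)))   ∎
      where
      open ≤-Reasoning
      rainbow-nbhd : Unique (map c (nbhd H v))
      rainbow-nbhd = map-unique⁺ c (λ p q → rainbow (∈-nbhd⁻ p) (∈-nbhd⁻ q)) (Unique.filter⁺ _ verts-unique)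

  Within2 : V → V → Set
  Within2 x y = T (adj x y) ⊎ ∃ λ w → T (adj w x) × T (adj w y)

  module _ {k′} (χ : CondColoring H k′ (maxDeg H)) (∈-verts : ∀ v → v ∈ verts) where
    open CondColoring χ

    -- deg w ≤ Δ, so the condition at r = Δ asks for deg w distinct colors on the neighborhood of w.
    nbhd-rainbow : ∀ w → Unique (map c (nbhd H w))
    nbhd-rainbow w = unique-if-length-deduplicate _≟ᶠ_ _ (begin
      length (map c (nbhd H w))                     ≡⟨ length-map c (nbhd H w) ⟩
      deg H w                                       ≡⟨ m≤n⇒m⊓n≡m (≤-foldr-⊔ (deg H) (∈-verts w)) ⟨
      deg H w ⊓ maxDeg H                            ≤⟨ condition w ⟩
      length (deduplicate _≟ᶠ_ (map c (nbhd H w)))  ∎)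
      where open ≤-Reasoning

    color-≢-Within2 : ∀ {x y} → x ≢ y → Within2 x y → c x ≢ c y
    color-≢-Within2 _ (inj₁ a) = proper _ _ a
    color-≢-Within2 x≢y (inj₂ (w , a , b)) e =
      x≢y (map-unique⁻ c (nbhd-rainbow w) (∈-nbhd⁺ (∈-verts _) a) (∈-nbhd⁺ (∈-verts _) b) e)

    ≤-colors : ∀ {p} (f : Fin p → V) →
               (∀ s t → s ≢ t → f s ≢ f t × Within2 (f s) (f t)) → p ≤ k′
    ≤-colors f spread = injective⇒≤ c∘f-injective
      where
      c∘f-injective : ∀ {s t} → c (f s) ≡ c (f t) → s ≡ t
      c∘f-injective {s} {t} e with s ≟ᶠ t
      ... | yes s≡t = s≡t
      ... | no s≢t = let (fs≢ft , near) = spread s t s≢t in ⊥-elim (color-≢-Within2 fs≢ft near e)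

module LineGraph (G : Graph) where
  open Graph G
  open ConditionalColoring (lineGraph G) using (Within2)

  pairs-∈⁻ : ∀ (l : List V) {a b} → (a , b) ∈ pairs G l → a ∈ l × b ∈ l
  pairs-∈⁻ (u ∷ vs) p with ∈-++⁻ (map (u ,_) vs) p
  ... | inj₁ q with ∈-map⁻ (u ,_) q
  ...   | (v , v∈ , refl) = here refl , there v∈
  pairs-∈⁻ (u ∷ vs) p | inj₂ q = let (a∈ , b∈) = pairs-∈⁻ vs q in there a∈ , there b∈

  pairs-∈⁺ : ∀ (l : List V) {a b} → a ∈ l → b ∈ l → a ≢ b →
             ∃ λ e → e ∈ pairs G l × Same e (a , b)
  pairs-∈⁺ (u ∷ vs) (here refl) (here refl) a≢b = ⊥-elim (a≢b refl)
  pairs-∈⁺ (u ∷ vs) (here refl) (there b∈) _ = _ , ∈-++⁺ˡ (∈-map⁺ (u ,_) b∈) , inj₁ refl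
  pairs-∈⁺ (u ∷ vs) (there a∈) (here refl) _ = _ , ∈-++⁺ˡ (∈-map⁺ (u ,_) a∈) , inj₂ refl
  pairs-∈⁺ (u ∷ vs) (there a∈) (there b∈) a≢b =
    let (e , e∈ , same) = pairs-∈⁺ vs a∈ b∈ a≢b in e , ∈-++⁺ʳ (map (u ,_) vs) e∈ , same

  pairs-unique : ∀ {l : List V} → Unique l → Unique (pairs G l)
  pairs-unique {[]} _ = []
  pairs-unique {u ∷ vs} (u∉ ∷ vs-unique) =
    Unique.++⁺ (Unique.map⁺ (cong proj₂) vs-unique) (pairs-unique vs-unique) disjoint
    where
    disjoint : ∀ {e} → e ∈ map (u ,_) vs × e ∈ pairs G vs → ⊥
    disjoint (p , q) with ∈-map⁻ (u ,_) p
    ... | (_ , _ , refl) = All.lookup u∉ (proj₁ (pairs-∈⁻ vs q)) refl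

  pairs-swap-∉ : ∀ {l : List V} → Unique l →
                 ∀ {a b} → (a , b) ∈ pairs G l → (b , a) ∈ pairs G l → ⊥
  pairs-swap-∉ {u ∷ vs} (u∉ ∷ vs-unique) p q with ∈-++⁻ (map (u ,_) vs) p | ∈-++⁻ (map (u ,_) vs) q
  ... | inj₁ p′ | inj₁ q′ with ∈-map⁻ (u ,_) p′ | ∈-map⁻ (u ,_) q′
  ...   | (_ , v∈ , refl) | (_ , _ , refl) = All.lookup u∉ v∈ refl
  pairs-swap-∉ {u ∷ vs} (u∉ ∷ vs-unique) p q | inj₁ p′ | inj₂ q′ with ∈-map⁻ (u ,_) p′
  ...   | (_ , _ , refl) = All.lookup u∉ (proj₂ (pairs-∈⁻ vs q′)) refl
  pairs-swap-∉ {u ∷ vs} (u∉ ∷ vs-unique) p q | inj₂ p′ | inj₁ q′ with ∈-map⁻ (u ,_) q′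
  ...   | (_ , _ , refl) = All.lookup u∉ (proj₂ (pairs-∈⁻ vs p′)) refl
  pairs-swap-∉ {u ∷ vs} (u∉ ∷ vs-unique) p q | inj₂ p′ | inj₂ q′ = pairs-swap-∉ vs-unique p′ q′

  L : ℕ
  L = length (edges G)

  edge : Fin L → V × V
  edge = lookup (edges G)

  ∈-edges⁻ : ∀ {e} → e ∈ edges G → e ∈ pairs G verts × T (adj (proj₁ e) (proj₂ e))
  ∈-edges⁻ e∈ = let (e∈pairs , a) = ∈-filter⁻ _ {xs = pairs G verts} e∈
                in e∈pairs , Equivalence.from T-≡ a

  edge-adj : ∀ x → T (adj (proj₁ (edge x)) (proj₂ (edge x)))
  edge-adj x = proj₂ (∈-edges⁻ (∈-lookup {xs = edges G} x))

  -- The test `share` local to lineGraph; the two agree definitionally.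
  shares : V × V → V × V → Bool
  shares (a , b) (c , d) = ⌊ a ≟ c ⌋ ∨ ⌊ a ≟ d ⌋ ∨ ⌊ b ≟ c ⌋ ∨ ⌊ b ≟ d ⌋

  shares⇒Meet : ∀ e f → T (shares e f) → Meet e f
  shares⇒Meet (a , b) (c , d) h with a ≟ c | a ≟ d | b ≟ c | b ≟ d
  ... | yes a≡c | _ | _ | _ = a , inj₁ refl , inj₁ a≡c
  ... | no _ | yes a≡d | _ | _ = a , inj₁ refl , inj₂ a≡d
  ... | no _ | no _ | yes b≡c | _ = b , inj₂ refl , inj₁ b≡c
  ... | no _ | no _ | no _ | yes b≡d = b , inj₂ refl , inj₂ b≡d

  Meet⇒shares : ∀ e f → Meet e f → T (shares e f)
  Meet⇒shares (a , b) (c , d) (z , z∈e , z∈f) with a ≟ c | a ≟ d | b ≟ c | b ≟ d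
  ... | yes _ | _ | _ | _ = _
  ... | no _ | yes _ | _ | _ = _
  ... | no _ | no _ | yes _ | _ = _
  ... | no _ | no _ | no _ | yes _ = _
  ... | no a≢c | no a≢d | no b≢c | no b≢d with z∈e | z∈f
  ...   | inj₁ refl | inj₁ refl = a≢c refl
  ...   | inj₁ refl | inj₂ refl = a≢d refl
  ...   | inj₂ refl | inj₁ refl = b≢c refl
  ...   | inj₂ refl | inj₂ refl = b≢d refl

  adj-lineGraph⁻ : ∀ {x y} → T (Graph.adj (lineGraph G) x y) → x ≢ y × Meet (edge x) (edge y)
  adj-lineGraph⁻ {x} {y} a with x ≟ᶠ y
  ... | no x≢y = x≢y , shares⇒Meet (edge x) (edge y) a

  adj-lineGraph⁺ : ∀ {x y} → x ≢ y → Meet (edge x) (edge y) → T (Graph.adj (lineGraph G) x y)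
  adj-lineGraph⁺ {x} {y} x≢y m with x ≟ᶠ y
  ... | yes x≡y = x≢y x≡y
  ... | no _ = Meet⇒shares (edge x) (edge y) m

  Within2-lineGraph : ∀ {w x y} → x ≢ y → Meet (edge w) (edge x) → Meet (edge w) (edge y) → Within2 x y
  Within2-lineGraph {w} {x} {y} x≢y mx my with w ≟ᶠ x | w ≟ᶠ y
  ... | yes refl | _ = inj₁ (adj-lineGraph⁺ x≢y my)
  ... | no _ | yes refl = inj₁ (adj-lineGraph⁺ x≢y (Meet-sym mx))
  ... | no w≢x | no w≢y = inj₂ (w , adj-lineGraph⁺ w≢x mx , adj-lineGraph⁺ w≢y my)

  module _ (verts-unique : Unique verts) where

    edge-injective : ∀ {x y} → Same (edge x) (edge y) → x ≡ y
    edge-injective {x} {y} (inj₁ e) = lookup-injective (Unique.filter⁺ _ (pairs-unique verts-unique)) x y e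
    edge-injective {x} {y} (inj₂ e) = ⊥-elim (pairs-swap-∉ verts-unique
      (proj₁ (∈-edges⁻ (∈-lookup {xs = edges G} y)))
      (proj₁ (∈-edges⁻ (subst (_∈ edges G) e (∈-lookup {xs = edges G} x)))))

  module _ (∈-verts : ∀ v → v ∈ verts)
           (adj-sym : ∀ u v → T (adj u v) → T (adj v u))
           (adj-irrefl : ∀ v → ¬ T (adj v v)) where

    lineVertex : ∀ u v → T (adj u v) → ∃ λ x → Same (edge x) (u , v)
    lineVertex u v a =
      let (e , e∈pairs , same) = pairs-∈⁺ verts (∈-verts u) (∈-verts v) (λ { refl → adj-irrefl u a })
          e∈ = ∈-filter⁺ _ e∈pairs (Equivalence.to T-≡ (adj-Same same))
      in index e∈ , subst (λ e′ → Same e′ (u , v)) (lookup-index e∈) same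
      where
      adj-Same : ∀ {e} → Same e (u , v) → T (adj (proj₁ e) (proj₂ e))
      adj-Same (inj₁ refl) = a
      adj-Same (inj₂ refl) = adj-sym u v a

choose₂ : ℕ → ℕ
choose₂ zero = 0
choose₂ (suc m) = m + choose₂ m

choose₂≡C2 : ∀ m → choose₂ m ≡ m C 2
choose₂≡C2 zero = refl
choose₂≡C2 (suc m) = trans (cong₂ _+_ (sym (nC1≡n m)) (choose₂≡C2 m)) (nCk+nC[k+1]≡[n+1]C[k+1] m 1)

↑ˡ≢↑ʳ : ∀ {m n} {i : Fin m} {j : Fin n} → i ↑ˡ n ≢ m ↑ʳ j
↑ˡ≢↑ʳ {m} {n} {i} {j} e with () ←
  trans (sym (splitAt-↑ˡ m i n)) (trans (cong (splitAt m) e) (splitAt-↑ʳ m n j))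

-- The pairs {0, b+1} fill the first block, the pairs avoiding 0 are indexed recursively in the second.
pairIndex : ∀ {m} (a b : Fin m) → .(a ≢ b) → Fin (choose₂ m)
pairIndex {suc m} zero zero a≢b = Irrelevant.⊥-elim (a≢b refl)
pairIndex {suc m} zero (suc b) _ = b ↑ˡ choose₂ m
pairIndex {suc m} (suc a) zero _ = a ↑ˡ choose₂ m
pairIndex {suc m} (suc a) (suc b) a≢b = m ↑ʳ pairIndex a b (λ e → a≢b (cong suc e))

pairIndex-comm : ∀ {m} (a b : Fin m) .(p : a ≢ b) .(q : b ≢ a) → pairIndex a b p ≡ pairIndex b a q
pairIndex-comm zero zero p _ = Irrelevant.⊥-elim (p refl)
pairIndex-comm zero (suc b) _ _ = refl
pairIndex-comm (suc a) zero _ _ = refl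
pairIndex-comm {suc m} (suc a) (suc b) _ _ = cong (m ↑ʳ_) (pairIndex-comm a b _ _)

pairIndex-injective : ∀ {m} (a b c d : Fin m) .(p : a ≢ b) .(q : c ≢ d) →
                      pairIndex a b p ≡ pairIndex c d q → Same (a , b) (c , d)
pairIndex-injective zero zero _ _ p _ _ = Irrelevant.⊥-elim (p refl)
pairIndex-injective _ _ zero zero _ q _ = Irrelevant.⊥-elim (q refl)
pairIndex-injective zero (suc b) zero (suc d) _ _ e = inj₁ (cong (zero ,_) (cong suc (↑ˡ-injective _ b d e)))
pairIndex-injective zero (suc b) (suc c) zero _ _ e = inj₂ (cong (zero ,_) (cong suc (↑ˡ-injective _ b c e)))
pairIndex-injective (suc a) zero zero (suc d) _ _ e = inj₂ (cong (_, zero) (cong suc (↑ˡ-injective _ a d e)))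
pairIndex-injective (suc a) zero (suc c) zero _ _ e = inj₁ (cong (_, zero) (cong suc (↑ˡ-injective _ a c e)))
pairIndex-injective zero (suc b) (suc c) (suc d) _ _ e = ⊥-elim (↑ˡ≢↑ʳ e)
pairIndex-injective (suc a) zero (suc c) (suc d) _ _ e = ⊥-elim (↑ˡ≢↑ʳ e)
pairIndex-injective (suc a) (suc b) zero (suc d) _ _ e = ⊥-elim (↑ˡ≢↑ʳ (sym e))
pairIndex-injective (suc a) (suc b) (suc c) zero _ _ e = ⊥-elim (↑ˡ≢↑ʳ (sym e))
pairIndex-injective {suc m} (suc a) (suc b) (suc c) (suc d) _ _ e
  with pairIndex-injective a b c d _ _ (↑ʳ-injective m _ _ e)
... | inj₁ refl = inj₁ refl
... | inj₂ refl = inj₂ refl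

pairIndex-surjective : ∀ {m} (t : Fin (choose₂ m)) →
                       ∃₂ λ (a b : Fin m) → Σ (a ≢ b) λ p → pairIndex a b p ≡ t
pairIndex-surjective {suc m} t with splitAt m t | join-splitAt m (choose₂ m) t
... | inj₁ b | t≡ = zero , suc b , (λ ()) , t≡
... | inj₂ u | t≡ with pairIndex-surjective {m} u
...   | a , b , a≢b , refl = suc a , suc b , (λ e → a≢b (suc-injective e)) , t≡

module Windmill (n m : ℕ) where

  open ≡-Reasoning

  G : Graph
  G = windmill (suc m) n

  open Graph G
  open LineGraph G
  open ConditionalColoring (lineGraph G)

  verts-unique : Unique verts
  verts-unique = All.tabulate nothing∉ ∷ Unique.map⁺ just-injective
                   (Unique.cartesianProduct⁺ (Unique.allFin⁺ n) (Unique.allFin⁺ m))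
    where
    nothing∉ : ∀ {v} → v ∈ map just (cartesianProduct (allFin n) (allFin m)) → nothing ≢ v
    nothing∉ v∈ with ∈-map⁻ just v∈
    ... | (_ , _ , refl) = λ ()

  ∈-verts : ∀ v → v ∈ verts
  ∈-verts nothing = here refl
  ∈-verts (just (i , j)) = there (∈-map⁺ just (∈-cartesianProduct⁺ (∈-allFin i) (∈-allFin j)))

  adj-just⁻ : ∀ {i j i′ j′} → T (adj (just (i , j)) (just (i′ , j′))) → i ≡ i′ × j ≢ j′
  adj-just⁻ {i} {j} {i′} {j′} a with i ≟ᶠ i′ | j ≟ᶠ j′
  ... | yes i≡i′ | no j≢j′ = i≡i′ , j≢j′

  adj-just⁺ : ∀ {i j j′} → .(j ≢ j′) → T (adj (just (i , j)) (just (i , j′)))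
  adj-just⁺ {i} {j} {j′} j≢j′ with i ≟ᶠ i | j ≟ᶠ j′
  ... | yes _ | no _ = _
  ... | no i≢i | _ = i≢i refl
  ... | _ | yes j≡j′ = Irrelevant.⊥-elim (j≢j′ j≡j′)

  adj-sym : ∀ u v → T (adj u v) → T (adj v u)
  adj-sym nothing (just _) _ = _
  adj-sym (just _) nothing _ = _
  adj-sym (just (i , j)) (just (i′ , j′)) a with adj-just⁻ {i} {j} {i′} {j′} a
  ... | refl , j≢j′ = adj-just⁺ (λ e → j≢j′ (sym e))

  adj-irrefl : ∀ v → ¬ T (adj v v)
  adj-irrefl (just (i , j)) a = proj₂ (adj-just⁻ {i} {j} {i} {j} a) refl

  data WdEdge : Set where
    spoke : Fin n × Fin m → WdEdge
    blade : (i : Fin n) (j j′ : Fin m) → .(j ≢ j′) → WdEdge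

  ends : WdEdge → V × V
  ends (spoke p) = nothing , just p
  ends (blade i j j′ _) = just (i , j) , just (i , j′)

  ends-adj : ∀ e → T (adj (proj₁ (ends e)) (proj₂ (ends e)))
  ends-adj (spoke _) = _
  ends-adj (blade _ _ _ j≢j′) = adj-just⁺ j≢j′

  classify : ∀ u v → T (adj u v) → ∃ λ e → Same (u , v) (ends e)
  classify nothing (just p) _ = spoke p , inj₁ refl
  classify (just p) nothing _ = spoke p , inj₂ refl
  classify (just (i , j)) (just (i′ , j′)) a with adj-just⁻ {i} {j} {i′} {j′} a
  ... | refl , j≢j′ = blade i j j′ j≢j′ , inj₁ refl

  Color : Set
  Color = Fin (n * m) ⊎ Fin (choose₂ m)

  -- Spokes get pairwise distinct colors; a blade is colored by its pair {j, j′} alone, whatever its copy.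
  color : WdEdge → Color
  color (spoke (i , j)) = inj₁ (combine i j)
  color (blade _ j j′ j≢j′) = inj₂ (pairIndex j j′ j≢j′)

  color-resp-Same : ∀ e f → Same (ends e) (ends f) → color e ≡ color f
  color-resp-Same (spoke _) (spoke _) (inj₁ refl) = refl
  color-resp-Same (spoke _) (spoke _) (inj₂ ())
  color-resp-Same (spoke _) (blade _ _ _ _) (inj₂ ())
  color-resp-Same (blade _ _ _ p) (blade _ _ _ q) (inj₁ refl) = refl
  color-resp-Same (blade _ _ _ p) (blade _ _ _ q) (inj₂ refl) = cong inj₂ (pairIndex-comm _ _ p q)

  ends-same-copy : ∀ e {i i′ j j′} →
                   Ends (just (i , j)) (ends e) → Ends (just (i′ , j′)) (ends e) → i ≡ i′
  ends-same-copy (spoke _) (inj₂ refl) (inj₂ refl) = refl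
  ends-same-copy (blade _ _ _ _) (inj₁ refl) (inj₁ refl) = refl
  ends-same-copy (blade _ _ _ _) (inj₁ refl) (inj₂ refl) = refl
  ends-same-copy (blade _ _ _ _) (inj₂ refl) (inj₁ refl) = refl
  ends-same-copy (blade _ _ _ _) (inj₂ refl) (inj₂ refl) = refl

  Meet-blade⇒copy : ∀ g {i j j′} → Meet (ends g) (just (i , j) , just (i , j′)) →
                    ∃ λ x → Ends (just (i , x)) (ends g)
  Meet-blade⇒copy g (_ , z∈g , inj₁ refl) = _ , z∈g
  Meet-blade⇒copy g (_ , z∈g , inj₂ refl) = _ , z∈g

  -- An edge meets at most one copy, so two blades with the same pair that meet a common edge coincide.
  color-injective-near : ∀ e f g → color e ≡ color f →
    Meet (ends g) (ends e) → Meet (ends g) (ends f) → Same (ends e) (ends f)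
  color-injective-near (spoke (i , j)) (spoke (i′ , j′)) _ c≡ _ _
    with combine-injective i j i′ j′ (inj₁-injective c≡)
  ... | refl , refl = inj₁ refl
  color-injective-near (blade i j j′ p) (blade i′ c d q) g c≡ g∼e g∼f
    with Meet-blade⇒copy g g∼e | Meet-blade⇒copy g g∼f
  ... | _ , x∈g | _ , y∈g
    with ends-same-copy g x∈g y∈g | pairIndex-injective j j′ c d p q (inj₂-injective c≡)
  ...   | refl | inj₁ refl = inj₁ refl
  ...   | refl | inj₂ refl = inj₂ refl

  data SpokeOrBladeOf (i₀ : Fin n) : WdEdge → Set where
    spoke : ∀ p → SpokeOrBladeOf i₀ (spoke p)
    blade : ∀ j j′ .(p : j ≢ j′) → SpokeOrBladeOf i₀ (blade i₀ j j′ p)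

  common-neighbor : ∀ {i₀ e f} → SpokeOrBladeOf i₀ e → SpokeOrBladeOf i₀ f →
                     ∃ λ g → Meet (ends g) (ends e) × Meet (ends g) (ends f)
  common-neighbor (spoke p) (spoke _) = spoke p , Meet-refl _ , (nothing , inj₁ refl , inj₁ refl)
  common-neighbor {i₀} (spoke _) (blade j _ _) =
    spoke (i₀ , j) , (nothing , inj₁ refl , inj₁ refl) , (just (i₀ , j) , inj₂ refl , inj₁ refl)
  common-neighbor {i₀} (blade j _ _) (spoke _) =
    spoke (i₀ , j) , (just (i₀ , j) , inj₂ refl , inj₁ refl) , (nothing , inj₁ refl , inj₁ refl)
  common-neighbor {i₀} (blade j j′ p) (blade c _ _) with j ≟ᶠ c
  ... | yes refl = blade i₀ j j′ p , Meet-refl _ , (just (i₀ , j) , inj₁ refl , inj₁ refl)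
  ... | no j≢c =
    blade i₀ j c j≢c , (just (i₀ , j) , inj₁ refl , inj₁ refl) , (just (i₀ , c) , inj₂ refl , inj₁ refl)

  classify-edge : ∀ x → ∃ λ e → Same (edge x) (ends e)
  classify-edge x = classify (proj₁ (edge x)) (proj₂ (edge x)) (edge-adj x)

  edgeAt : Fin L → WdEdge
  edgeAt x = proj₁ (classify-edge x)

  edge-edgeAt : ∀ x → Same (edge x) (ends (edgeAt x))
  edge-edgeAt x = proj₂ (classify-edge x)

  lineVertex-ends : ∀ e → ∃ λ x → Same (edge x) (ends e)
  lineVertex-ends e = lineVertex ∈-verts adj-sym adj-irrefl (proj₁ (ends e)) (proj₂ (ends e)) (ends-adj e)

  lineVertexOf : WdEdge → Fin L
  lineVertexOf e = proj₁ (lineVertex-ends e)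

  edge-lineVertexOf : ∀ e → Same (edge (lineVertexOf e)) (ends e)
  edge-lineVertexOf e = proj₂ (lineVertex-ends e)

  color-edgeAt-lineVertexOf : ∀ e → color (edgeAt (lineVertexOf e)) ≡ color e
  color-edgeAt-lineVertexOf e =
    color-resp-Same _ _ (Same-trans (Same-sym (edge-edgeAt _)) (edge-lineVertexOf e))

  M : ℕ
  M = n * m + m C 2

  M-≡ : n * m + choose₂ m ≡ M
  M-≡ = cong (n * m +_) (choose₂≡C2 m)

  toFin : Color → Fin M
  toFin s = cast M-≡ (join (n * m) (choose₂ m) s)

  fromFin : Fin M → Color
  fromFin t = splitAt (n * m) (cast (sym M-≡) t)

  toFin-fromFin : ∀ t → toFin (fromFin t) ≡ t
  toFin-fromFin t =
    trans (cong (cast M-≡) (join-splitAt (n * m) (choose₂ m) _)) (cast-involutive M-≡ (sym M-≡) t)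

  fromFin-toFin : ∀ s → fromFin (toFin s) ≡ s
  fromFin-toFin s =
    trans (cong (splitAt (n * m)) (cast-involutive (sym M-≡) M-≡ _)) (splitAt-join (n * m) (choose₂ m) s)

  lineColor : Fin L → Fin M
  lineColor x = toFin (color (edgeAt x))

  lineColor-injective-near : ∀ {w x y} → lineColor x ≡ lineColor y →
    Meet (edge w) (edge x) → Meet (edge w) (edge y) → x ≡ y
  lineColor-injective-near {w} {x} {y} c≡ w∼x w∼y = edge-injective verts-unique (Same-trans (edge-edgeAt x)
    (Same-trans (color-injective-near (edgeAt x) (edgeAt y) (edgeAt w) color≡
                   (Meet-resp-Same (edge-edgeAt w) (edge-edgeAt x) w∼x)
                   (Meet-resp-Same (edge-edgeAt w) (edge-edgeAt y) w∼y))
                (Same-sym (edge-edgeAt y))))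
    where
    color≡ : color (edgeAt x) ≡ color (edgeAt y)
    color≡ = trans (sym (fromFin-toFin _)) (trans (cong fromFin c≡) (fromFin-toFin _))

  module _ (i₀ : Fin n) where

    representative : Color → WdEdge
    representative (inj₁ t) = let (i , j , _) = combine-surjective {n} {m} t in spoke (i , j)
    representative (inj₂ t) =
      let (j , j′ , j≢j′ , _) = pairIndex-surjective {m} t in blade i₀ j j′ j≢j′

    color-representative : ∀ s → color (representative s) ≡ s
    color-representative (inj₁ t) = cong inj₁ (proj₂ (proj₂ (combine-surjective {n} {m} t)))
    color-representative (inj₂ t) = cong inj₂ (proj₂ (proj₂ (proj₂ (pairIndex-surjective {m} t))))

    representative-spokeOrBlade : ∀ s → SpokeOrBladeOf i₀ (representative s)
    representative-spokeOrBlade (inj₁ t) = spoke _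
    representative-spokeOrBlade (inj₂ t) = blade _ _ _

    upperBound : 0 < M → ∀ r → CondColoring (lineGraph G) M r
    upperBound M>0 r = rainbow⇒condColoring r lineColor M>0 (Unique.allFin⁺ L) surjective proper rainbow
      where
      surjective : ∀ t → ∃ λ x → lineColor x ≡ t
      surjective t = lineVertexOf e , (begin
        toFin (color (edgeAt (lineVertexOf e))) ≡⟨ cong toFin (color-edgeAt-lineVertexOf e) ⟩
        toFin (color e)                         ≡⟨ cong toFin (color-representative (fromFin t)) ⟩
        toFin (fromFin t)                        ≡⟨ toFin-fromFin t ⟩
        t                                        ∎)
        where e = representative (fromFin t)
      proper : ∀ x y → T (Graph.adj (lineGraph G) x y) → lineColor x ≢ lineColor y
      proper x y a c≡ =
        let (x≢y , x∼y) = adj-lineGraph⁻ a in x≢y (lineColor-injective-near c≡ (Meet-refl _) x∼y)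
      rainbow : ∀ {w x y} → T (Graph.adj (lineGraph G) w x) → T (Graph.adj (lineGraph G) w y) →
                lineColor x ≡ lineColor y → x ≡ y
      rainbow a b c≡ = lineColor-injective-near c≡ (proj₂ (adj-lineGraph⁻ a)) (proj₂ (adj-lineGraph⁻ b))

    lowerBound : ∀ k′ → CondColoring (lineGraph G) k′ (maxDeg (lineGraph G)) → M ≤ k′
    lowerBound k′ χ = ≤-colors χ ∈-allFin f spread
      where
      e : Fin M → WdEdge
      e t = representative (fromFin t)
      f : Fin M → Fin L
      f t = lineVertexOf (e t)
      f-injective : ∀ {s t} → f s ≡ f t → s ≡ t
      f-injective {s} {t} fs≡ft = begin
        s                             ≡⟨ toFin-fromFin s ⟨
        toFin (fromFin s)             ≡⟨ cong toFin (color-representative (fromFin s)) ⟨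
        toFin (color (e s))          ≡⟨ cong toFin (color-edgeAt-lineVertexOf (e s)) ⟨
        toFin (color (edgeAt (f s))) ≡⟨ cong (λ x → toFin (color (edgeAt x))) fs≡ft ⟩
        toFin (color (edgeAt (f t))) ≡⟨ cong toFin (color-edgeAt-lineVertexOf (e t)) ⟩
        toFin (color (e t))          ≡⟨ cong toFin (color-representative (fromFin t)) ⟩
        toFin (fromFin t)             ≡⟨ toFin-fromFin t ⟩
        t                             ∎
      near : ∀ g e′ → Meet (ends g) (ends e′) → Meet (edge (lineVertexOf g)) (edge (lineVertexOf e′))
      near g e′ = Meet-resp-Same (Same-sym (edge-lineVertexOf g)) (Same-sym (edge-lineVertexOf e′))
      spread : ∀ s t → s ≢ t → f s ≢ f t × Within2 (f s) (f t)
      spread s t s≢t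
        with common-neighbor (representative-spokeOrBlade (fromFin s)) (representative-spokeOrBlade (fromFin t))
      ... | g , g∼s , g∼t = fs≢ft , Within2-lineGraph fs≢ft (near g (e s) g∼s) (near g (e t) g∼t)
        where
        fs≢ft : f s ≢ f t
        fs≢ft fs≡ft = s≢t (f-injective fs≡ft)

proposition2 : ∀ (k n : ℕ) → 2 ≤ k → 1 ≤ n →
  IsCondChromatic (lineGraph (windmill k n)) (maxDeg (lineGraph (windmill k n)))
    (n * (k ∸ 1) + (k ∸ 1) C 2)
proposition2 (suc (suc a)) (suc b) _ _ = upperBound zero (s≤s z≤n) _ , lowerBound zero
  where open Windmill (suc b) (suc a)
proposition2 (suc zero) _ (s≤s ()) _
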